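{- Let $m>1$ and let $C_m$ be the category defined in the context. Then $C_m$ is a Möbius category, and for every morphism $f$ of $C_m$ the Lawvere interval $I(f)$ is (as a category) a finite lattice.
   Context: Let $m>1$ be an integer, $\mathbb{Z}_m$ the cyclic group of integers modulo $m$ (residue class of an integer $n$ written $\overline{n}$), $\mathbb{Z}_-$ the set of non-positive integers and $\mathbb{Z}_+$ the set of non-negative integers. The category $C_m$ has object set $\mathbb{Z}_m\times\mathbb{Z}_-$; for objects $(\overline{x},i),(\overline{y},j)$, $\mathrm{Hom}_{C_m}((\overline{x},i),(\overline{y},j))=\{(a,\overline{x},i,j)\mid a\in\mathbb{Z}_+,\ a\le i-j,\ \overline{a}+\overline{x}=\overline{y}\}$; composition is $(b,\overline{y},j,k)\circ(a,\overline{x},i,j)=(a+b,\overline{x},i,k)$ (identities are $(0,\overline{x},i,i)$). A small category $C$ is Möbius (in the sense of Leroux) if (1) every morphism has only finitely many factorizations $f=g\circ h$, and (2) an incidence function $\xi:\mathrm{Mor}\,C\to\mathbb{C}$ has an inverse for the convolution $(\xi*\eta)(f)=\sum_{f=g\circ h}\xi(g)\eta(h)$ (whose identity is $\delta$, with $\delta(f)=1$ if $f$ is an identity and $0$ otherwise) if and only if $\xi(f)\neq0$ for every identity morphism $f$. For a morphism $f$ of $C$, the Lawvere interval $I(f)$ is the category whose objects are the factorizations $f=u\circ v$ in $C$ (pairs $(v,u)$ with $u\circ v=f$), and a morphism from $(v,u)$ to $(v',u')$ is a morphism $h$ of $C$ from the codomain of $v$ to the codomain of $v'$ with $h\circ v=v'$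 and $u'\circ h=u$, composition as in $C$. A category is a finite lattice if it is the category of a finite lattice, i.e. it has finitely many objects, at most one morphism between any two objects, it is one-way (morphisms in both directions only between equal objects), and the resulting partial order is a lattice. -}

module Defs where

open import Level using (0ℓ) renaming (suc to lsuc)
open import Data.Nat as ℕ using (ℕ; zero; suc; NonZero; >-nonZero)
open import Data.Nat.DivMod using (_%_)
open import Data.Nat.Properties as ℕP using ()
open import Data.Fin using (Fin; toℕ)
open import Data.Integer as ℤ using (ℤ; +_; _-_)
open import Data.Product using (Σ; Σ-syntax; ∃; ∃-syntax; _×_; _,_)
open import Function.Bundles using (_↔_)
open import Relation.Nullary using (¬_)
open import Relation.Binary.PropositionalEquality using (_≡_; refl; subst; cong; sym)
open import Relation.Binary.Lattice.Structures using (IsLattice)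
open import Algebra.Bundles using (CommutativeRing)

record Category : Set₁ where
  infixr 9 _∘_
  field
    Obj : Set
    Hom : Obj → Obj → Set
    id  : ∀ {A} → Hom A A
    _∘_ : ∀ {A B C} → Hom B C → Hom A B → Hom A C
    identityˡ : ∀ {A B} (f : Hom A B) → id ∘ f ≡ f
    identityʳ : ∀ {A B} (f : Hom A B) → f ∘ id ≡ f
    assoc : ∀ {A B C D} (h : Hom C D) (g : Hom B C) (f : Hom A B) →
            (h ∘ g) ∘ f ≡ h ∘ (g ∘ f)

Finite : Set → Set
Finite T = ∃[ n ] (T ↔ Fin n)

module _ (C : Category) where
  open Category C

  IsIdentity : ∀ {A B} → Hom A B → Set
  IsIdentity {A} {B} f = Σ[ p ∈ A ≡ B ] (subst (Hom A) p id ≡ f)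

  Factorization : ∀ {A B} → Hom A B → Set
  Factorization {A} {B} f = Σ[ X ∈ Obj ] Σ[ h ∈ Hom A X ] Σ[ g ∈ Hom X B ] (g ∘ h ≡ f)

  FiniteFactorizations : Set
  FiniteFactorizations = ∀ {A B} (f : Hom A B) → Finite (Factorization f)

  module Incidence {c ℓ} (K : CommutativeRing c ℓ)
                   (fin : FiniteFactorizations) where
    open CommutativeRing K renaming (Carrier to K₀)
    open Data.Product using (proj₁; proj₂)
    open Function.Bundles.Inverse using (from)

    sumK : (n : ℕ) → (Fin n → K₀) → K₀
    sumK zero    φ = 0#
    sumK (suc n) φ = φ Fin.zero + sumK n (λ i → φ (Fin.suc i))
      where import Data.Fin as Fin

    IncidenceFunction : Set c
    IncidenceFunction = ∀ {A B} → Hom A B → K₀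

    conv : IncidenceFunction → IncidenceFunction → IncidenceFunction
    conv ξ η f = sumK (proj₁ (fin f)) term
      where
      term : Fin (proj₁ (fin f)) → K₀
      term i with from (proj₂ (fin f)) i
      ... | (X , h , g , _) = ξ g * η h

    IsDelta : IncidenceFunction → Set ℓ
    IsDelta ζ = ∀ {A B} (f : Hom A B) →
                (IsIdentity f → ζ f ≈ 1#) × (¬ IsIdentity f → ζ f ≈ 0#)

    HasInverse : IncidenceFunction → Set (c Level.⊔ ℓ)
    HasInverse ξ = Σ[ η ∈ IncidenceFunction ] (IsDelta (conv ξ η) × IsDelta (conv η ξ))

IsField : ∀ {c ℓ} → CommutativeRing c ℓ → Set (c Level.⊔ ℓ)
IsField K = ¬ (1# ≈ 0#) × (∀ x → ¬ (x ≈ 0#) → ∃[ y ] (x * y ≈ 1#))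
  where open CommutativeRing K

IsMöbius : ∀ {c ℓ} (K : CommutativeRing c ℓ) → Category → Set (c Level.⊔ ℓ)
IsMöbius K C =
  Σ[ fin ∈ FiniteFactorizations C ]
    (∀ (ξ : Incidence.IncidenceFunction C K fin) →
      (Incidence.HasInverse C K fin ξ →
         ∀ {A} → ¬ (ξ (Category.id C {A}) ≈ 0#))
      × ((∀ {A} → ¬ (ξ (Category.id C {A}) ≈ 0#)) →
         Incidence.HasInverse C K fin ξ))
  where open CommutativeRing K using (_≈_; 0#)

module _ (C : Category) where
  open Category C

  record IObj {A B : Obj} (f : Hom A B) : Set where
    constructor fact
    field
      mid : Obj
      v   : Hom A mid
      u   : Hom mid B
      eq  : u ∘ v ≡ f

  IHom : ∀ {A B} {f : Hom A B} → IObj f → IObj f → Set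
  IHom (fact X v u _) (fact X' v' u' _) =
    Σ[ h ∈ Hom X X' ] ((h ∘ v ≡ v') × (u' ∘ h ≡ u))

LawvereInterval : (C : Category) → ∀ {A B} → Category.Hom C A B → Category
LawvereInterval C {A} {B} f = record
  { Obj = IObj C f
  ; Hom = IHom C
  ; id  = λ { {fact X v u e} → id , identityˡ v , identityʳ u }
  ; _∘_ = λ { {fact _ v₁ u₁ _} {fact _ v₂ u₂ _} {fact _ v₃ u₃ _}
              (k , kv , uk) (h , hv , uh) →
              k ∘ h
              , trans (assoc k h v₁) (trans (cong (k ∘_) hv) kv)
              , trans (sym (assoc u₃ k h)) (trans (cong (_∘ h) uk) uh) }
  ; identityˡ = λ { (h , _ , _) → Σ-≡ (identityˡ h) }
  ; identityʳ = λ { (h , _ , _) → Σ-≡ (identityʳ h) }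
  ; assoc = λ { (k , _) (h , _) (g , _) → Σ-≡ (assoc k h g) }
  }
  where
  open Category C
  open Relation.Binary.PropositionalEquality using (trans)
  -- (uses UIP, available since K is on)
  Σ-≡ : ∀ {X Y Z W : Obj} {v : Hom Z X} {v' : Hom Z Y} {u : Hom X W} {u' : Hom Y W}
        {a b : Σ (Hom X Y) (λ h → (h ∘ v ≡ v') × (u' ∘ h ≡ u))} →
        Data.Product.proj₁ a ≡ Data.Product.proj₁ b → a ≡ b
  Σ-≡ {a = h , refl , refl} {b = .h , refl , p} refl = cong (λ p → h , refl , p) (uip _ p)
    where
    uip : ∀ {T : Set} {x y : T} (p q : x ≡ y) → p ≡ q
    uip refl refl = refl

record IsFiniteLattice (C : Category) : Set₁ where
  open Category C
  field
    finiteObj : Finite Obj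
    thin      : ∀ {a b} (f g : Hom a b) → f ≡ g
    oneWay    : ∀ {a b} → Hom a b → Hom b a → a ≡ b
    -- the induced partial order  a ≤ b  ⇔  Hom a b  is a lattice
    lattice   : Σ[ join ∈ (Obj → Obj → Obj) ] Σ[ meet ∈ (Obj → Obj → Obj) ]
                  IsLattice _≡_ Hom join meet

module CmDef (m : ℕ) (1<m : 1 ℕ.< m) where
  open import Data.Integer.Properties as ℤP using ()
  open Relation.Binary.PropositionalEquality using (trans)

  instance
    m≢0 : NonZero m
    m≢0 = >-nonZero (ℕP.<-trans ℕ.z<s 1<m)

  -- residue class of x + a  equals  y  in ℤ_m  (ℤ_m represented by Fin m)
  _+̄_≡̄_ : Fin m → ℕ → Fin m → Set
  x +̄ a ≡̄ y = (toℕ x ℕ.+ a) % m ≡ toℕ y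

  record CObj : Set where
    constructor obj
    field
      res   : Fin m
      lev   : ℤ
      .nonpos : lev ℤ.≤ ℤ.0ℤ

  record CHom (X Y : CObj) : Set where
    constructor mor
    field
      a     : ℕ
      .bound : + a ℤ.≤ CObj.lev X - CObj.lev Y
      .resid : CObj.res X +̄ a ≡̄ CObj.res Y
  open CHom

  mor-≡ : ∀ {X Y} {f g : CHom X Y} → a f ≡ a g → f ≡ g
  mor-≡ refl = refl

  cid : ∀ {X} → CHom X X
  cid {obj x i _} = mor 0 (ℤP.i≤j⇒0≤j-i (ℤP.≤-refl {i}))
                      (trans (cong (_% m) (ℕP.+-identityʳ (toℕ x)))
                             (m<n⇒m%n≡m (toℕ<n x)))
    where open import Data.Nat.DivMod using (m<n⇒m%n≡m)
          open import Data.Fin.Properties using (toℕ<n)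

  _∘C_ : ∀ {X Y Z} → CHom Y Z → CHom X Y → CHom X Z
  _∘C_ {obj x i _} {obj y j _} {obj z k _} (mor b bb rb) (mor a ba ra) =
    mor (a ℕ.+ b)
        (subst (ℤ._≤ i - k) (sym (ℤP.pos-+ a b))
          (subst (+ a ℤ.+ + b ℤ.≤_) (ℤP.+-minus-telescope i j k)
            (ℤP.+-mono-≤ ba bb)))
        (begin
          (toℕ x ℕ.+ (a ℕ.+ b)) % m      ≡⟨ cong (_% m) (sym (ℕP.+-assoc (toℕ x) a b)) ⟩
          (toℕ x ℕ.+ a ℕ.+ b) % m        ≡⟨ %-distribˡ-+ (toℕ x ℕ.+ a) b m ⟩
          ((toℕ x ℕ.+ a) % m ℕ.+ b % m) % m
            ≡⟨ cong (λ t → (t ℕ.+ b % m) % m) (sym (m%n%n≡m%n (toℕ x ℕ.+ a) m)) ⟩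
          ((toℕ x ℕ.+ a) % m % m ℕ.+ b % m) % m
            ≡⟨ sym (%-distribˡ-+ ((toℕ x ℕ.+ a) % m) b m) ⟩
          ((toℕ x ℕ.+ a) % m ℕ.+ b) % m  ≡⟨ cong (λ t → (t ℕ.+ b) % m) ra ⟩
          (toℕ y ℕ.+ b) % m              ≡⟨ rb ⟩
          toℕ z ∎)
    where open Relation.Binary.PropositionalEquality.≡-Reasoning
          open import Data.Nat.DivMod using (%-distribˡ-+; m%n%n≡m%n)

  Cm : Category
  Cm = record
    { Obj = CObj
    ; Hom = CHom
    ; id  = cid
    ; _∘_ = _∘C_
    ; identityˡ = λ { {obj _ _ _} {obj _ _ _} f → mor-≡ (ℕP.+-identityʳ (a f)) }
    ; identityʳ = λ { {obj _ _ _} {obj _ _ _} f → refl }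
    ; assoc = λ { {obj _ _ _} {obj _ _ _} {obj _ _ _} {obj _ _ _} h g f →
                  mor-≡ (sym (ℕP.+-assoc (a f) (a g) (a h))) }
    }

C : (m : ℕ) → 1 ℕ.< m → Category
C = CmDef.Cm

module Submission where

-- A morphism g : (x̄ , i) → (ȳ , j) of C_m is determined by its source and two
-- natural numbers: its length a and its slack (i − j) − a.  Every pair (a , s)
-- occurs, and composition adds both coordinates, so C_m is the category of a free
-- action of the monoid ℕ² on its objects.
--
-- * A factorization f = u ∘ v is determined by the coordinates of v, which range
--   over the box [0 , a f] × [0 , slack f]; and v ≤ v′ in I(f) iff the coordinates
--   of v are below those of v′.  So I(f) is a product of two finite chains.
-- * The box also bounds the number of factorizations.  Reading incidence functions
--   on coordinates identifies the convolution of C_m with the convolution of the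
--   ℕ²-action, where (Φ ⋆ ρ) at (a , s) is Φ at the origin times ρ at (a , s) plus
--   terms of lower degree a + s.  So over a field a right inverse can be solved
--   for degree by degree, and right inverses are two-sided by associativity.

open import Defs
open import Level using (0ℓ)
open import Data.Nat as ℕ using (ℕ; zero; suc; _∸_; _<_; _≤_)
import Data.Nat.Properties as ℕP
open import Data.Nat.DivMod using (_%_; %-distribˡ-+; m%n%n≡m%n; m<n⇒m%n≡m; m%n<n)
open import Data.Fin as Fin using (Fin; toℕ; fromℕ<; _↑ˡ_; _↑ʳ_; combine)
import Data.Fin.Properties as FinP
open import Data.Integer as ℤ using (ℤ; +_; ∣_∣)
import Data.Integer.Properties as ℤP
open import Data.Integer.Tactic.RingSolver using (solve-∀)
open import Data.Product using (Σ; Σ-syntax; _×_; _,_; proj₁; proj₂)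
open import Data.Empty using (⊥-elim)
open import Relation.Nullary using (¬_)
open import Relation.Nullary.Decidable using (recompute)
open import Relation.Binary.Bundles using (Setoid)
open import Relation.Binary.PropositionalEquality as ≡ using (_≡_)
open import Algebra.Bundles using (CommutativeRing)
open import Algebra.Properties.CommutativeSemigroup ℕP.+-commutativeSemigroup
  using () renaming (interchange to +-interchange)

module Arithmetic where
  open ≡ using (refl; sym; trans; cong; subst; module ≡-Reasoning)

  -- a₁ + s₁ < a + s whenever (a₁ , s₁) lies strictly below (a , s) in ℕ²;
  -- this is the degree that drops in the triangular inversion
  below-total : ∀ {a s} a₁ a₂ s₁ s₂ → a₁ ℕ.+ a₂ ≡ a → s₁ ℕ.+ s₂ ≡ s →
                0 < a₂ ℕ.+ s₂ → a₁ ℕ.+ s₁ < a ℕ.+ s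
  below-total a₁ a₂ s₁ s₂ refl refl 0<a₂+s₂ =
    subst (a₁ ℕ.+ s₁ <_) (+-interchange a₁ s₁ a₂ s₂) (ℕP.m<m+n (a₁ ℕ.+ s₁) 0<a₂+s₂)

  [m%d+n]%d≡[m+n]%d : ∀ m n d .{{_ : ℕ.NonZero d}} → (m % d ℕ.+ n) % d ≡ (m ℕ.+ n) % d
  [m%d+n]%d≡[m+n]%d m n d = begin
    (m % d ℕ.+ n) % d           ≡⟨ %-distribˡ-+ (m % d) n d ⟩
    (m % d % d ℕ.+ n % d) % d   ≡⟨ cong (λ t → (t ℕ.+ n % d) % d) (m%n%n≡m%n m d) ⟩
    (m % d ℕ.+ n % d) % d       ≡⟨ %-distribˡ-+ m n d ⟨
    (m ℕ.+ n) % d               ∎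
    where open ≡-Reasoning

  drop-diff : ∀ {x y : ℤ} {n : ℕ} → x ≡ y ℤ.+ + n → x ℤ.- y ≡ + n
  drop-diff {x} {y} {n} x≡y+n = trans (cong (ℤ._- y) x≡y+n) (cancel y (+ n))
    where
    cancel : ∀ y u → y ℤ.+ u ℤ.- y ≡ u
    cancel = solve-∀

  drop-unique : ∀ {x y : ℤ} {p q : ℕ} → x ≡ y ℤ.+ + p → x ≡ y ℤ.+ + q → p ≡ q
  drop-unique {x} {y} x≡y+p x≡y+q =
    ℤP.+-injective (trans (sym (drop-diff {x} {y} x≡y+p)) (drop-diff {x} {y} x≡y+q))

  drop-sub : ∀ {x y : ℤ} {n : ℕ} → x ≡ y ℤ.+ + n → y ≡ x ℤ.- + n
  drop-sub {x} {y} {n} x≡y+n = trans (cancel y (+ n)) (cong (ℤ._- + n) (sym x≡y+n))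
    where
    cancel : ∀ y u → y ≡ y ℤ.+ u ℤ.- u
    cancel = solve-∀

  drop-trans : ∀ {x y z : ℤ} {p q : ℕ} → x ≡ y ℤ.+ + p → y ≡ z ℤ.+ + q →
               x ≡ z ℤ.+ + (p ℕ.+ q)
  drop-trans {x} {y} {z} {p} {q} x≡y+p y≡z+q = begin
    x                    ≡⟨ x≡y+p ⟩
    y ℤ.+ + p            ≡⟨ cong (ℤ._+ + p) y≡z+q ⟩
    z ℤ.+ + q ℤ.+ + p    ≡⟨ shuffle z (+ q) (+ p) ⟩
    z ℤ.+ (+ p ℤ.+ + q)  ≡⟨ cong (λ t → z ℤ.+ t) (ℤP.pos-+ p q) ⟨
    z ℤ.+ + (p ℕ.+ q)    ∎
    where
    open ≡-Reasoning
    shuffle : ∀ z u v → z ℤ.+ u ℤ.+ v ≡ z ℤ.+ (v ℤ.+ u)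
    shuffle = solve-∀

  drop-cancelˡ : ∀ {x y z : ℤ} {n d : ℕ} → x ≡ y ℤ.+ + n → x ≡ z ℤ.+ + (n ℕ.+ d) →
                 y ≡ z ℤ.+ + d
  drop-cancelˡ {x} {y} {z} {n} {d} x≡y+n x≡z+n+d = begin
    y                            ≡⟨ add-sub y (+ n) ⟩
    y ℤ.+ + n ℤ.- + n            ≡⟨ cong (ℤ._- + n) (trans (sym x≡y+n) x≡z+n+d) ⟩
    z ℤ.+ + (n ℕ.+ d) ℤ.- + n    ≡⟨ cong (λ t → z ℤ.+ t ℤ.- + n) (ℤP.pos-+ n d) ⟩
    z ℤ.+ (+ n ℤ.+ + d) ℤ.- + n  ≡⟨ add-sub′ z (+ n) (+ d) ⟩
    z ℤ.+ + d                    ∎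
    where
    open ≡-Reasoning
    add-sub : ∀ y u → y ≡ y ℤ.+ u ℤ.- u
    add-sub = solve-∀
    add-sub′ : ∀ z u v → z ℤ.+ (u ℤ.+ v) ℤ.- u ≡ z ℤ.+ v
    add-sub′ = solve-∀

open Arithmetic

module AntidiagonalSums {c ℓ} (K : CommutativeRing c ℓ) where
  open CommutativeRing K renaming (Carrier to K₀)
  open import Relation.Binary.Reasoning.Setoid setoid
  open import Algebra.Properties.CommutativeSemigroup +-commutativeSemigroup
    using (interchange)
  open import Algebra.Properties.Semiring.Sum semiring using (sum)

  -- Σ⟨ n ⟩ f  =  Σ_{i + j = n} f i j
  Σ⟨_⟩ : ℕ → (ℕ → ℕ → K₀) → K₀
  Σ⟨ zero ⟩  f = f 0 0
  Σ⟨ suc n ⟩ f = f 0 (suc n) + Σ⟨ n ⟩ (λ i j → f (suc i) j)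

  Σ-cong : ∀ n {f g : ℕ → ℕ → K₀} → (∀ i j → i ℕ.+ j ≡ n → f i j ≈ g i j) →
           Σ⟨ n ⟩ f ≈ Σ⟨ n ⟩ g
  Σ-cong zero    f≈g = f≈g 0 0 ≡.refl
  Σ-cong (suc n) f≈g =
    +-cong (f≈g 0 (suc n) ≡.refl) (Σ-cong n (λ i j e → f≈g (suc i) j (≡.cong suc e)))

  Σ-cong′ : ∀ n {f g : ℕ → ℕ → K₀} → (∀ i j → f i j ≈ g i j) → Σ⟨ n ⟩ f ≈ Σ⟨ n ⟩ g
  Σ-cong′ n f≈g = Σ-cong n (λ i j _ → f≈g i j)

  Σ-+ : ∀ n (f g : ℕ → ℕ → K₀) → Σ⟨ n ⟩ (λ i j → f i j + g i j) ≈ Σ⟨ n ⟩ f + Σ⟨ n ⟩ g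
  Σ-+ zero    f g = refl
  Σ-+ (suc n) f g = trans (+-cong refl (Σ-+ n _ _)) (interchange _ _ _ _)

  Σ-zero : ∀ n → Σ⟨ n ⟩ (λ _ _ → 0#) ≈ 0#
  Σ-zero zero    = refl
  Σ-zero (suc n) = trans (+-identityˡ _) (Σ-zero n)

  *-Σ : ∀ n x (f : ℕ → ℕ → K₀) → x * Σ⟨ n ⟩ f ≈ Σ⟨ n ⟩ (λ i j → x * f i j)
  *-Σ zero    x f = refl
  *-Σ (suc n) x f = trans (distribˡ x _ _) (+-cong refl (*-Σ n x _))

  Σ-* : ∀ n x (f : ℕ → ℕ → K₀) → Σ⟨ n ⟩ f * x ≈ Σ⟨ n ⟩ (λ i j → f i j * x)
  Σ-* zero    x f = refl
  Σ-* (suc n) x f = trans (distribʳ x _ _) (+-cong refl (Σ-* n x _))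

  Σ-comm : ∀ n k (F : ℕ → ℕ → ℕ → ℕ → K₀) →
           Σ⟨ n ⟩ (λ i j → Σ⟨ k ⟩ (F i j)) ≈ Σ⟨ k ⟩ (λ p q → Σ⟨ n ⟩ (λ i j → F i j p q))
  Σ-comm zero    k F = refl
  Σ-comm (suc n) k F =
    trans (+-cong refl (Σ-comm n k (λ i → F (suc i)))) (sym (Σ-+ k (F 0 (suc n)) _))

  -- Both sides are the sum of F i k l over all i + k + l = n.
  Σ-assoc : ∀ n (F : ℕ → ℕ → ℕ → K₀) →
            Σ⟨ n ⟩ (λ i j → Σ⟨ j ⟩ (λ k l → F i k l)) ≈ Σ⟨ n ⟩ (λ i j → Σ⟨ i ⟩ (λ k l → F k l j))
  Σ-assoc zero    F = refl
  Σ-assoc (suc n) F = begin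
    (F 0 0 (suc n) + Σ⟨ n ⟩ (λ k l → F 0 (suc k) l))
      + Σ⟨ n ⟩ (λ i j → Σ⟨ j ⟩ (λ k l → F (suc i) k l))
      ≈⟨ +-assoc _ _ _ ⟩
    F 0 0 (suc n) + (Σ⟨ n ⟩ (λ k l → F 0 (suc k) l)
      + Σ⟨ n ⟩ (λ i j → Σ⟨ j ⟩ (λ k l → F (suc i) k l)))
      ≈⟨ +-cong refl (+-cong refl (Σ-assoc n (λ i → F (suc i)))) ⟩
    F 0 0 (suc n) + (Σ⟨ n ⟩ (λ i j → F 0 (suc i) j)
      + Σ⟨ n ⟩ (λ i j → Σ⟨ i ⟩ (λ k l → F (suc k) l j)))
      ≈⟨ +-cong refl (sym (Σ-+ n _ _)) ⟩
    F 0 0 (suc n) + Σ⟨ n ⟩ (λ i j → F 0 (suc i) j + Σ⟨ i ⟩ (λ k l → F (suc k) l j)) ∎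

  δ₀ : ℕ → K₀
  δ₀ zero    = 1#
  δ₀ (suc _) = 0#

  Σ-δʳ : ∀ n (f : ℕ → ℕ → K₀) → Σ⟨ n ⟩ (λ i j → δ₀ j * f i j) ≈ f n 0
  Σ-δʳ zero    f = *-identityˡ _
  Σ-δʳ (suc n) f = trans (+-cong (zeroˡ _) (Σ-δʳ n (λ i → f (suc i)))) (+-identityˡ _)

  Σ-δˡ : ∀ n (f : ℕ → ℕ → K₀) → Σ⟨ n ⟩ (λ i j → δ₀ i * f i j) ≈ f 0 n
  Σ-δˡ zero    f = *-identityˡ _
  Σ-δˡ (suc n) f =
    trans (+-cong (*-identityˡ _) (trans (Σ-cong′ n (λ i j → zeroˡ _)) (Σ-zero n)))
          (+-identityʳ _)

  offOrigin : ℕ → ℕ → K₀ → K₀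
  offOrigin zero    zero    x = 0#
  offOrigin zero    (suc _) x = x
  offOrigin (suc _) _       x = x

  origin+offOrigin : ∀ p q x → x ≈ δ₀ p * (δ₀ q * x) + offOrigin p q x
  origin+offOrigin zero zero x =
    sym (trans (+-identityʳ _) (trans (*-identityˡ _) (*-identityˡ _)))
  origin+offOrigin zero (suc q) x =
    sym (trans (+-cong (trans (*-identityˡ _) (zeroˡ _)) refl) (+-identityˡ _))
  origin+offOrigin (suc p) q x = sym (trans (+-cong (zeroˡ _) refl) (+-identityˡ _))

  Σ²-split : ∀ a s (X : ℕ → ℕ → ℕ → ℕ → K₀) →
    Σ⟨ a ⟩ (λ a₁ a₂ → Σ⟨ s ⟩ (λ s₁ s₂ → X a₁ a₂ s₁ s₂))
      ≈ X a 0 s 0 + Σ⟨ a ⟩ (λ a₁ a₂ → Σ⟨ s ⟩ (λ s₁ s₂ → offOrigin a₂ s₂ (X a₁ a₂ s₁ s₂)))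
  Σ²-split a s X = begin
    Σ⟨ a ⟩ (λ a₁ a₂ → Σ⟨ s ⟩ (λ s₁ s₂ → X a₁ a₂ s₁ s₂))
      ≈⟨ Σ-cong′ a (λ a₁ a₂ → Σ-cong′ s (λ s₁ s₂ → origin+offOrigin a₂ s₂ _)) ⟩
    Σ⟨ a ⟩ (λ a₁ a₂ → Σ⟨ s ⟩ (λ s₁ s₂ → Origin a₁ a₂ s₁ s₂ + Off a₁ a₂ s₁ s₂))
      ≈⟨ Σ-cong′ a (λ a₁ a₂ → Σ-+ s _ _) ⟩
    Σ⟨ a ⟩ (λ a₁ a₂ → Σ⟨ s ⟩ (Origin a₁ a₂) + Σ⟨ s ⟩ (Off a₁ a₂))
      ≈⟨ Σ-+ a _ _ ⟩
    Σ⟨ a ⟩ (λ a₁ a₂ → Σ⟨ s ⟩ (Origin a₁ a₂)) + Σ⟨ a ⟩ (λ a₁ a₂ → Σ⟨ s ⟩ (Off a₁ a₂))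
      ≈⟨ +-cong origin refl ⟩
    X a 0 s 0 + Σ⟨ a ⟩ (λ a₁ a₂ → Σ⟨ s ⟩ (Off a₁ a₂)) ∎
    where
    Origin Off : ℕ → ℕ → ℕ → ℕ → K₀
    Origin a₁ a₂ s₁ s₂ = δ₀ a₂ * (δ₀ s₂ * X a₁ a₂ s₁ s₂)
    Off a₁ a₂ s₁ s₂ = offOrigin a₂ s₂ (X a₁ a₂ s₁ s₂)
    origin : Σ⟨ a ⟩ (λ a₁ a₂ → Σ⟨ s ⟩ (Origin a₁ a₂)) ≈ X a 0 s 0
    origin = trans (Σ-cong′ a (λ a₁ a₂ → trans (sym (*-Σ s _ _))
                                               (*-cong refl (Σ-δʳ s (λ s₁ s₂ → X a₁ a₂ s₁ s₂)))))
                   (Σ-δʳ a (λ a₁ a₂ → X a₁ a₂ s 0))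

  sum-↑ : ∀ p q (φ : Fin (p ℕ.+ q) → K₀) →
          sum φ ≈ sum (λ i → φ (i ↑ˡ q)) + sum (λ j → φ (p ↑ʳ j))
  sum-↑ zero    q φ = sym (+-identityˡ _)
  sum-↑ (suc p) q φ = trans (+-cong refl (sum-↑ p q (λ i → φ (Fin.suc i)))) (sym (+-assoc _ _ _))

  sum-combine : ∀ p q (φ : Fin (p ℕ.* q) → K₀) →
                sum φ ≈ sum (λ (i : Fin p) → sum (λ (j : Fin q) → φ (combine i j)))
  sum-combine zero    q φ = refl
  sum-combine (suc p) q φ =
    trans (sum-↑ q (p ℕ.* q) φ) (+-cong refl (sum-combine p q (λ k → φ (q ↑ʳ k))))

  sum-antidiagonal : ∀ n (f : ℕ → ℕ → K₀) →
                     sum (λ (i : Fin (suc n)) → f (toℕ i) (n ∸ toℕ i)) ≈ Σ⟨ n ⟩ f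
  sum-antidiagonal zero    f = +-identityʳ _
  sum-antidiagonal (suc n) f = +-cong refl (sum-antidiagonal n (λ i → f (suc i)))

-- The convolution algebra of a free action of the monoid (ℕ² , +) on a set O:
-- the arrows out of A are the pairs (a , s), the arrow (a , s) goes to shift A a s,
-- and composing arrows adds the pairs.
module ActionAlgebra {c ℓ} (K : CommutativeRing c ℓ) (O : Set)
    (shift : O → ℕ → ℕ → O)
    (shift-+ : ∀ A k₁ s₁ k₂ s₂ →
               shift (shift A k₁ s₁) k₂ s₂ ≡ shift A (k₁ ℕ.+ k₂) (s₁ ℕ.+ s₂))
    (shift-0 : ∀ A → shift A 0 0 ≡ A) where
  open CommutativeRing K renaming (Carrier to K₀)
  open AntidiagonalSums K

  -- Φ A a s is the value on the unique arrow out of A with coordinates (a , s).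
  Fn : Set c
  Fn = O → ℕ → ℕ → K₀

  infix 4 _∼_
  _∼_ : Fn → Fn → Set ℓ
  Φ ∼ Ψ = ∀ A a s → Φ A a s ≈ Ψ A a s

  Fn-setoid : Setoid c ℓ
  Fn-setoid = record
    { Carrier = Fn
    ; _≈_ = _∼_
    ; isEquivalence = record
      { refl = λ _ _ _ → refl
      ; sym = λ p A a s → sym (p A a s)
      ; trans = λ p q A a s → trans (p A a s) (q A a s) } }

  infixl 7 _⋆_
  _⋆_ : Fn → Fn → Fn
  (Φ ⋆ Ψ) A a s = Σ⟨ a ⟩ (λ a₁ a₂ → Σ⟨ s ⟩ (λ s₁ s₂ → Φ (shift A a₁ s₁) a₂ s₂ * Ψ A a₁ s₁))

  δ : Fn
  δ A a s = δ₀ a * δ₀ s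

  ⋆-cong : ∀ {Φ Φ′ Ψ Ψ′} → Φ ∼ Φ′ → Ψ ∼ Ψ′ → Φ ⋆ Ψ ∼ Φ′ ⋆ Ψ′
  ⋆-cong Φ∼ Ψ∼ A a s = Σ-cong′ a (λ _ _ → Σ-cong′ s (λ _ _ → *-cong (Φ∼ _ _ _) (Ψ∼ _ _ _)))

  ⋆-identityˡ : ∀ Ψ → δ ⋆ Ψ ∼ Ψ
  ⋆-identityˡ Ψ A a s = begin
    Σ⟨ a ⟩ (λ a₁ a₂ → Σ⟨ s ⟩ (λ s₁ s₂ → (δ₀ a₂ * δ₀ s₂) * Ψ A a₁ s₁))
      ≈⟨ Σ-cong′ a (λ a₁ a₂ → trans (Σ-cong′ s (λ s₁ s₂ → *-assoc _ _ _)) (sym (*-Σ s _ _))) ⟩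
    Σ⟨ a ⟩ (λ a₁ a₂ → δ₀ a₂ * Σ⟨ s ⟩ (λ s₁ s₂ → δ₀ s₂ * Ψ A a₁ s₁))
      ≈⟨ Σ-cong′ a (λ a₁ a₂ → *-cong refl (Σ-δʳ s (λ s₁ s₂ → Ψ A a₁ s₁))) ⟩
    Σ⟨ a ⟩ (λ a₁ a₂ → δ₀ a₂ * Ψ A a₁ s)
      ≈⟨ Σ-δʳ a (λ a₁ a₂ → Ψ A a₁ s) ⟩
    Ψ A a s ∎
    where open import Relation.Binary.Reasoning.Setoid setoid

  ⋆-identityʳ : ∀ Φ → Φ ⋆ δ ∼ Φ
  ⋆-identityʳ Φ A a s = begin
    Σ⟨ a ⟩ (λ a₁ a₂ → Σ⟨ s ⟩ (λ s₁ s₂ → Φ (shift A a₁ s₁) a₂ s₂ * (δ₀ a₁ * δ₀ s₁)))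
      ≈⟨ Σ-cong′ a (λ a₁ a₂ → trans (Σ-cong′ s (λ s₁ s₂ → rotate _ _ _)) (sym (*-Σ s _ _))) ⟩
    Σ⟨ a ⟩ (λ a₁ a₂ → δ₀ a₁ * Σ⟨ s ⟩ (λ s₁ s₂ → δ₀ s₁ * Φ (shift A a₁ s₁) a₂ s₂))
      ≈⟨ Σ-cong′ a (λ a₁ a₂ → *-cong refl (Σ-δˡ s (λ s₁ s₂ → Φ (shift A a₁ s₁) a₂ s₂))) ⟩
    Σ⟨ a ⟩ (λ a₁ a₂ → δ₀ a₁ * Φ (shift A a₁ 0) a₂ s)
      ≈⟨ Σ-δˡ a (λ a₁ a₂ → Φ (shift A a₁ 0) a₂ s) ⟩
    Φ (shift A 0 0) a s
      ≡⟨ ≡.cong (λ X → Φ X a s) (shift-0 A) ⟩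
    Φ A a s ∎
    where
    open import Relation.Binary.Reasoning.Setoid setoid
    rotate : ∀ x y z → x * (y * z) ≈ y * (z * x)
    rotate x y z = trans (*-comm x _) (*-assoc y z x)

  -- Associativity: both sides sum Φ * Ψ * Χ over all splittings of (a , s) into
  -- three consecutive arrows; the middle step identifies the two ways of reaching
  -- the source of the last arrow, using the action law shift-+.
  ⋆-assoc : ∀ Φ Ψ Χ → (Φ ⋆ Ψ) ⋆ Χ ∼ Φ ⋆ (Ψ ⋆ Χ)
  ⋆-assoc Φ Ψ Χ A a s = begin
    Σ⟨ a ⟩ (λ a₁ a₂ → Σ⟨ s ⟩ (λ s₁ s₂ → (Φ ⋆ Ψ) (shift A a₁ s₁) a₂ s₂ * Χ A a₁ s₁))
      ≈⟨ Σ-cong′ a (λ a₁ a₂ → Σ-cong′ s (λ s₁ s₂ →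
           trans (Σ-* a₂ _ _) (Σ-cong′ a₂ (λ b₁ b₂ → Σ-* s₂ _ _)))) ⟩
    Σ⟨ a ⟩ (λ a₁ a₂ → Σ⟨ s ⟩ (λ s₁ s₂ → Σ⟨ a₂ ⟩ (λ b₁ b₂ → Σ⟨ s₂ ⟩ (λ u₁ u₂ →
      L a₁ s₁ b₁ u₁ b₂ u₂))))
      ≈⟨ Σ-cong′ a (λ a₁ a₂ → Σ-comm s a₂ _) ⟩
    Σ⟨ a ⟩ (λ a₁ a₂ → Σ⟨ a₂ ⟩ (λ b₁ b₂ → Σ⟨ s ⟩ (λ s₁ s₂ → Σ⟨ s₂ ⟩ (λ u₁ u₂ →
      L a₁ s₁ b₁ u₁ b₂ u₂))))
      ≈⟨ Σ-assoc a (λ a₁ b₁ b₂ → Σ⟨ s ⟩ (λ s₁ s₂ → Σ⟨ s₂ ⟩ (λ u₁ u₂ → L a₁ s₁ b₁ u₁ b₂ u₂))) ⟩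
    Σ⟨ a ⟩ (λ c₁ c₂ → Σ⟨ c₁ ⟩ (λ d₁ d₂ → Σ⟨ s ⟩ (λ s₁ s₂ → Σ⟨ s₂ ⟩ (λ u₁ u₂ →
      L d₁ s₁ d₂ u₁ c₂ u₂))))
      ≈⟨ Σ-cong′ a (λ c₁ c₂ → Σ-cong′ c₁ (λ d₁ d₂ → Σ-assoc s _)) ⟩
    Σ⟨ a ⟩ (λ c₁ c₂ → Σ⟨ c₁ ⟩ (λ d₁ d₂ → Σ⟨ s ⟩ (λ v₁ v₂ → Σ⟨ v₁ ⟩ (λ w₁ w₂ →
      L d₁ w₁ d₂ w₂ c₂ v₂))))
      ≈⟨ Σ-cong a (λ c₁ c₂ _ → Σ-cong c₁ (λ d₁ d₂ d₁+d₂ → Σ-cong′ s (λ v₁ v₂ →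
           Σ-cong v₁ (λ w₁ w₂ w₁+w₂ → L≈R c₁ c₂ d₁ d₂ v₁ v₂ w₁ w₂ d₁+d₂ w₁+w₂)))) ⟩
    Σ⟨ a ⟩ (λ c₁ c₂ → Σ⟨ c₁ ⟩ (λ d₁ d₂ → Σ⟨ s ⟩ (λ v₁ v₂ → Σ⟨ v₁ ⟩ (λ w₁ w₂ →
      R c₁ v₁ c₂ v₂ d₁ w₁ d₂ w₂))))
      ≈⟨ Σ-cong′ a (λ c₁ c₂ → sym (Σ-comm s c₁ _)) ⟩
    Σ⟨ a ⟩ (λ c₁ c₂ → Σ⟨ s ⟩ (λ v₁ v₂ → Σ⟨ c₁ ⟩ (λ d₁ d₂ → Σ⟨ v₁ ⟩ (λ w₁ w₂ →
      R c₁ v₁ c₂ v₂ d₁ w₁ d₂ w₂))))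
      ≈⟨ Σ-cong′ a (λ c₁ c₂ → Σ-cong′ s (λ v₁ v₂ →
           sym (trans (*-Σ c₁ _ _) (Σ-cong′ c₁ (λ d₁ d₂ → *-Σ v₁ _ _))))) ⟩
    Σ⟨ a ⟩ (λ c₁ c₂ → Σ⟨ s ⟩ (λ v₁ v₂ → Φ (shift A c₁ v₁) c₂ v₂ * (Ψ ⋆ Χ) A c₁ v₁)) ∎
    where
    open import Relation.Binary.Reasoning.Setoid setoid
    L : ℕ → ℕ → ℕ → ℕ → ℕ → ℕ → K₀
    L a₁ s₁ b₁ u₁ b₂ u₂ =
      (Φ (shift (shift A a₁ s₁) b₁ u₁) b₂ u₂ * Ψ (shift A a₁ s₁) b₁ u₁) * Χ A a₁ s₁
    R : ℕ → ℕ → ℕ → ℕ → ℕ → ℕ → ℕ → ℕ → K₀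
    R c₁ v₁ c₂ v₂ d₁ w₁ d₂ w₂ = Φ (shift A c₁ v₁) c₂ v₂ * (Ψ (shift A d₁ w₁) d₂ w₂ * Χ A d₁ w₁)
    L≈R : ∀ c₁ c₂ d₁ d₂ v₁ v₂ w₁ w₂ → d₁ ℕ.+ d₂ ≡ c₁ → w₁ ℕ.+ w₂ ≡ v₁ →
          L d₁ w₁ d₂ w₂ c₂ v₂ ≈ R c₁ v₁ c₂ v₂ d₁ w₁ d₂ w₂
    L≈R c₁ c₂ d₁ d₂ v₁ v₂ w₁ w₂ ≡.refl ≡.refl =
      trans (*-assoc _ _ _)
            (*-cong (reflexive (≡.cong (λ X → Φ X c₂ v₂) (shift-+ A d₁ w₁ d₂ w₂))) refl)

  ⋆-origin : ∀ Φ Ψ A → (Φ ⋆ Ψ) A 0 0 ≈ Φ A 0 0 * Ψ A 0 0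
  ⋆-origin Φ Ψ A = *-cong (reflexive (≡.cong (λ X → Φ X 0 0) (shift-0 A))) refl

  -- The part of (Φ ⋆ Ψ) A a s that only involves Ψ at points strictly below (a , s).
  lower : Fn → Fn → Fn
  lower Φ Ψ A a s = Σ⟨ a ⟩ (λ a₁ a₂ → Σ⟨ s ⟩ (λ s₁ s₂ →
                      offOrigin a₂ s₂ (Φ (shift A a₁ s₁) a₂ s₂ * Ψ A a₁ s₁)))

  ⋆-split : ∀ Φ Ψ A a s → (Φ ⋆ Ψ) A a s ≈ Φ (shift A a s) 0 0 * Ψ A a s + lower Φ Ψ A a s
  ⋆-split Φ Ψ A a s = Σ²-split a s (λ a₁ a₂ s₁ s₂ → Φ (shift A a₁ s₁) a₂ s₂ * Ψ A a₁ s₁)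

  lower-cong : ∀ Φ Ψ Ψ′ A a s →
               (∀ a₁ s₁ → a₁ ℕ.+ s₁ ℕ.< a ℕ.+ s → Ψ A a₁ s₁ ≈ Ψ′ A a₁ s₁) →
               lower Φ Ψ A a s ≈ lower Φ Ψ′ A a s
  lower-cong Φ Ψ Ψ′ A a s Ψ≈ =
    Σ-cong a (λ a₁ a₂ ea → Σ-cong s (λ s₁ s₂ es → term a₁ a₂ s₁ s₂ ea es))
    where
    term : ∀ a₁ a₂ s₁ s₂ → a₁ ℕ.+ a₂ ≡ a → s₁ ℕ.+ s₂ ≡ s →
           offOrigin a₂ s₂ (Φ (shift A a₁ s₁) a₂ s₂ * Ψ A a₁ s₁)
             ≈ offOrigin a₂ s₂ (Φ (shift A a₁ s₁) a₂ s₂ * Ψ′ A a₁ s₁)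
    term a₁ zero    s₁ zero     ea es = refl
    term a₁ zero    s₁ (suc s₂) ea es =
      *-cong refl (Ψ≈ a₁ s₁ (below-total a₁ 0 s₁ (suc s₂) ea es (ℕ.s≤s ℕ.z≤n)))
    term a₁ (suc a₂) s₁ s₂      ea es =
      *-cong refl (Ψ≈ a₁ s₁ (below-total a₁ (suc a₂) s₁ s₂ ea es (ℕ.s≤s ℕ.z≤n)))

  -- Solving Φ ⋆ ρ = δ degree by degree: by ⋆-split, (Φ ⋆ ρ) A a s is the
  -- invertible value Φ (shift A a s) 0 0 times ρ A a s plus terms of lower degree.
  module RightInverse (Φ : Fn) (inv : O → K₀) (inv-correct : ∀ X → Φ X 0 0 * inv X ≈ 1#) where
    -- approx n is correct at all points of total degree a + s < n
    approx : ℕ → Fn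
    approx zero    A a s = 0#
    approx (suc n) A a s = inv (shift A a s) * (δ A a s - lower Φ (approx n) A a s)

    approx-stable : ∀ n n′ A a s → a ℕ.+ s ℕ.< n → a ℕ.+ s ℕ.< n′ →
                    approx n A a s ≈ approx n′ A a s
    approx-stable (suc n) (suc n′) A a s (ℕ.s≤s d≤n) (ℕ.s≤s d≤n′) =
      *-cong refl (+-cong refl (-‿cong (lower-cong Φ (approx n) (approx n′) A a s
        (λ a₁ s₁ lt → approx-stable n n′ A a₁ s₁ (ℕP.<-≤-trans lt d≤n) (ℕP.<-≤-trans lt d≤n′)))))

    -- the right inverse: at (a , s) use an approximation correct in degree a + s
    ρ : Fn
    ρ A a s = approx (suc (a ℕ.+ s)) A a s

    ⋆-inverseʳ : Φ ⋆ ρ ∼ δ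
    ⋆-inverseʳ A a s = begin
      (Φ ⋆ ρ) A a s
        ≈⟨ ⋆-split Φ ρ A a s ⟩
      Φ (shift A a s) 0 0 * ρ A a s + lower Φ ρ A a s
        ≈⟨ +-cong refl (lower-cong Φ ρ (approx (a ℕ.+ s)) A a s
             (λ a₁ s₁ lt → approx-stable _ _ A a₁ s₁ ℕP.≤-refl lt)) ⟩
      Φ (shift A a s) 0 0 * (inv (shift A a s) * (δ A a s - Rest)) + Rest
        ≈⟨ +-cong (sym (*-assoc _ _ _)) refl ⟩
      (Φ (shift A a s) 0 0 * inv (shift A a s)) * (δ A a s - Rest) + Rest
        ≈⟨ +-cong (trans (*-cong (inv-correct _) refl) (*-identityˡ _)) refl ⟩
      (δ A a s - Rest) + Rest
        ≈⟨ //-rightDividesˡ Rest (δ A a s) ⟩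
      δ A a s ∎
      where
      open import Relation.Binary.Reasoning.Setoid setoid
      open import Algebra.Properties.Group +-group using (//-rightDividesˡ)
      Rest : K₀
      Rest = lower Φ (approx (a ℕ.+ s)) A a s

  right-inverse-two-sided : ∀ Φ ρ σ → Φ ⋆ ρ ∼ δ → ρ ⋆ σ ∼ δ → ρ ⋆ Φ ∼ δ
  right-inverse-two-sided Φ ρ σ Φρ∼δ ρσ∼δ = begin
    ρ ⋆ Φ               ≈⟨ ⋆-cong {ρ} {ρ} (λ _ _ _ → refl) Φ∼σ ⟩
    ρ ⋆ σ               ≈⟨ ρσ∼δ ⟩
    δ                   ∎
    where
    open import Relation.Binary.Reasoning.Setoid Fn-setoid
    Φ∼σ : Φ ∼ σ
    Φ∼σ = begin
      Φ                 ≈⟨ ⋆-identityʳ Φ ⟨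
      Φ ⋆ δ             ≈⟨ ⋆-cong {Φ} {Φ} (λ _ _ _ → refl) ρσ∼δ ⟨
      Φ ⋆ (ρ ⋆ σ)       ≈⟨ ⋆-assoc Φ ρ σ ⟨
      (Φ ⋆ ρ) ⋆ σ       ≈⟨ ⋆-cong Φρ∼δ (λ _ _ _ → refl) ⟩
      δ ⋆ σ             ≈⟨ ⋆-identityˡ σ ⟩
      σ                 ∎

  origin-nonzero : ¬ (1# ≈ 0#) → ∀ Φ Ψ A → (Φ ⋆ Ψ) A 0 0 ≈ 1# →
                   ¬ (Φ A 0 0 ≈ 0#) × ¬ (Ψ A 0 0 ≈ 0#)
  origin-nonzero 1≉0 Φ Ψ A ΦΨ≈1 =
    (λ Φ≈0 → 1≉0 (trans unit (trans (*-cong Φ≈0 refl) (zeroˡ _))))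
    , (λ Ψ≈0 → 1≉0 (trans unit (trans (*-cong refl Ψ≈0) (zeroʳ _))))
    where
    unit : 1# ≈ Φ A 0 0 * Ψ A 0 0
    unit = trans (sym ΦΨ≈1) (⋆-origin Φ Ψ A)

  ⋆-rightInverse : IsField K → ∀ Φ → (∀ X → ¬ (Φ X 0 0 ≈ 0#)) → Σ[ ρ ∈ Fn ] (Φ ⋆ ρ ∼ δ)
  ⋆-rightInverse (_ , inverse) Φ Φ≉0 = ρ , ⋆-inverseʳ
    where open RightInverse Φ (λ X → proj₁ (inverse _ (Φ≉0 X))) (λ X → proj₂ (inverse _ (Φ≉0 X)))

  ⋆-inverse : IsField K → ∀ Φ → (∀ X → ¬ (Φ X 0 0 ≈ 0#)) →
              Σ[ ρ ∈ Fn ] (Φ ⋆ ρ ∼ δ × ρ ⋆ Φ ∼ δ)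
  ⋆-inverse isField@(1≉0 , _) Φ Φ≉0 with ⋆-rightInverse isField Φ Φ≉0
  ... | ρ , Φρ∼δ with ⋆-rightInverse isField ρ ρ≉0
    where
    ρ≉0 : ∀ X → ¬ (ρ X 0 0 ≈ 0#)
    ρ≉0 X = proj₂ (origin-nonzero 1≉0 Φ ρ X (trans (Φρ∼δ X 0 0) (*-identityˡ 1#)))
  ... | σ , ρσ∼δ = ρ , Φρ∼δ , right-inverse-two-sided Φ ρ σ Φρ∼δ ρσ∼δ

module Coordinates (m : ℕ) (1<m : 1 < m) where
  open ≡ using (refl; sym; trans; cong; cong₂; subst; module ≡-Reasoning)
  open CmDef m 1<m public
  open CObj public
  open CHom public using (a)

  _⊕_ : Fin m → ℕ → Fin m
  x ⊕ k = fromℕ< (m%n<n (toℕ x ℕ.+ k) m)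

  toℕ-⊕ : ∀ x k → toℕ (x ⊕ k) ≡ (toℕ x ℕ.+ k) % m
  toℕ-⊕ x k = FinP.toℕ-fromℕ< _

  ⊕-identityʳ : ∀ x → x ⊕ 0 ≡ x
  ⊕-identityʳ x = FinP.toℕ-injective (begin
    toℕ (x ⊕ 0)           ≡⟨ toℕ-⊕ x 0 ⟩
    (toℕ x ℕ.+ 0) % m     ≡⟨ cong (_% m) (ℕP.+-identityʳ (toℕ x)) ⟩
    toℕ x % m             ≡⟨ m<n⇒m%n≡m (FinP.toℕ<n x) ⟩
    toℕ x                 ∎)
    where open ≡-Reasoning

  ⊕-assoc : ∀ x k l → (x ⊕ k) ⊕ l ≡ x ⊕ (k ℕ.+ l)
  ⊕-assoc x k l = FinP.toℕ-injective (begin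
    toℕ ((x ⊕ k) ⊕ l)                 ≡⟨ toℕ-⊕ (x ⊕ k) l ⟩
    (toℕ (x ⊕ k) ℕ.+ l) % m           ≡⟨ cong (λ t → (t ℕ.+ l) % m) (toℕ-⊕ x k) ⟩
    ((toℕ x ℕ.+ k) % m ℕ.+ l) % m     ≡⟨ [m%d+n]%d≡[m+n]%d (toℕ x ℕ.+ k) l m ⟩
    (toℕ x ℕ.+ k ℕ.+ l) % m           ≡⟨ cong (_% m) (ℕP.+-assoc (toℕ x) k l) ⟩
    (toℕ x ℕ.+ (k ℕ.+ l)) % m         ≡⟨ toℕ-⊕ x (k ℕ.+ l) ⟨
    toℕ (x ⊕ (k ℕ.+ l))               ∎)
    where open ≡-Reasoning

  obj-≡ : ∀ {X Y} → res X ≡ res Y → lev X ≡ lev Y → X ≡ Y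
  obj-≡ {obj r l _} {obj .r .l _} refl refl = refl

  bound : ∀ {X Y} (g : CHom X Y) → + a g ℤ.≤ lev X ℤ.- lev Y
  bound {X} {Y} (mor k b _) = recompute (+ k ℤ.≤? lev X ℤ.- lev Y) b

  residue : ∀ {X Y} (g : CHom X Y) → res Y ≡ res X ⊕ a g
  residue {X} {Y} (mor k _ r) = FinP.toℕ-injective
    (trans (sym (recompute ((toℕ (res X) ℕ.+ k) % m ℕ.≟ toℕ (res Y)) r))
           (sym (toℕ-⊕ (res X) k)))

  slack : ∀ {X Y} → CHom X Y → ℕ
  slack {X} {Y} g = ∣ lev X ℤ.- lev Y ∣ ∸ a g

  drop : ∀ {X Y} (g : CHom X Y) → lev X ≡ lev Y ℤ.+ + (a g ℕ.+ slack g)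
  drop {X} {Y} g = begin
    lev X                        ≡⟨ split (lev X) (lev Y) ⟩
    lev Y ℤ.+ D                  ≡⟨ cong (λ t → lev Y ℤ.+ t) +∣D∣≡D ⟨
    lev Y ℤ.+ + ∣ D ∣            ≡⟨ cong (λ n → lev Y ℤ.+ + n) (ℕP.m+[n∸m]≡n a≤∣D∣) ⟨
    lev Y ℤ.+ + (a g ℕ.+ slack g) ∎
    where
    open ≡-Reasoning
    D : ℤ
    D = lev X ℤ.- lev Y
    +∣D∣≡D : + ∣ D ∣ ≡ D
    +∣D∣≡D = ℤP.0≤i⇒+∣i∣≡i (ℤP.≤-trans (ℤ.+≤+ ℕ.z≤n) (bound g))
    a≤∣D∣ : a g ≤ ∣ D ∣
    a≤∣D∣ = ℤP.drop‿+≤+ (subst (+ a g ℤ.≤_) (sym +∣D∣≡D) (bound g))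
    split : ∀ x y → x ≡ y ℤ.+ (x ℤ.- y)
    split = solve-∀

  mkHom : ∀ {X Y} k s → lev X ≡ lev Y ℤ.+ + (k ℕ.+ s) → res X ⊕ k ≡ res Y → CHom X Y
  mkHom {X} {Y} k s d r =
    mor k (subst (+ k ℤ.≤_) (sym (drop-diff d)) (ℤ.+≤+ (ℕP.m≤m+n k s)))
          (trans (sym (toℕ-⊕ (res X) k)) (cong toℕ r))

  slack-mkHom : ∀ {X Y} k s d r → slack (mkHom {X} {Y} k s d r) ≡ s
  slack-mkHom {X} {Y} k s d r =
    ℕP.+-cancelˡ-≡ k _ _ (drop-unique {lev X} {lev Y} (drop (mkHom {X} {Y} k s d r)) d)

  slack-∘ : ∀ {X Y Z} (g : CHom Y Z) (h : CHom X Y) → slack (g ∘C h) ≡ slack h ℕ.+ slack g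
  slack-∘ {X} {Y} {Z} g h = ℕP.+-cancelˡ-≡ (a h ℕ.+ a g) _ _ (begin
    a h ℕ.+ a g ℕ.+ slack (g ∘C h)
      ≡⟨ drop-unique {lev X} {lev Z} (drop (g ∘C h))
                     (drop-trans {lev X} {lev Y} {lev Z} (drop h) (drop g)) ⟩
    (a h ℕ.+ slack h) ℕ.+ (a g ℕ.+ slack g)
      ≡⟨ +-interchange (a h) (slack h) (a g) (slack g) ⟩
    a h ℕ.+ a g ℕ.+ (slack h ℕ.+ slack g) ∎)
    where open ≡-Reasoning

  Arrow : CObj → Set
  Arrow A = Σ CObj (CHom A)

  arrow-≡ : ∀ {A B B′} {f : CHom A B} {f′ : CHom A B′} → B ≡ B′ → a f ≡ a f′ →
            _≡_ {A = Arrow A} (B , f) (B′ , f′)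
  arrow-≡ refl a≡ = cong (_ ,_) (mor-≡ a≡)

  target : CObj → ℕ → ℕ → CObj
  target (obj x i i≤0) k s =
    obj (x ⊕ k) (i ℤ.- + (k ℕ.+ s)) (ℤP.≤-trans (ℤP.i-j≤i i (+ (k ℕ.+ s))) i≤0)

  target-drop : ∀ A k s → lev A ≡ lev (target A k s) ℤ.+ + (k ℕ.+ s)
  target-drop A k s = sub-add (lev A) (+ (k ℕ.+ s))
    where sub-add : ∀ i u → i ≡ i ℤ.- u ℤ.+ u
          sub-add = solve-∀

  canonical : ∀ A k s → CHom A (target A k s)
  canonical A k s = mkHom k s (target-drop A k s) refl

  slack-canonical : ∀ A k s → slack (canonical A k s) ≡ s
  slack-canonical A k s = slack-mkHom {A} {target A k s} k s (target-drop A k s) refl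

  arrow : ∀ A → ℕ → ℕ → Arrow A
  arrow A k s = target A k s , canonical A k s

  arrow-coords : ∀ {A B} (g : CHom A B) → (B , g) ≡ arrow A (a g) (slack g)
  arrow-coords {A} {B} g = arrow-≡ (obj-≡ (residue g) (drop-sub {lev A} {lev B} (drop g))) refl

  target-+ : ∀ A k₁ s₁ k₂ s₂ →
             target (target A k₁ s₁) k₂ s₂ ≡ target A (k₁ ℕ.+ k₂) (s₁ ℕ.+ s₂)
  target-+ A k₁ s₁ k₂ s₂ = obj-≡ (⊕-assoc (res A) k₁ k₂) (drop-sub (begin
    lev A
      ≡⟨ drop-trans {lev A} {lev (target A k₁ s₁)} {lev T}
                    (target-drop A k₁ s₁) (target-drop (target A k₁ s₁) k₂ s₂) ⟩
    lev T ℤ.+ + ((k₁ ℕ.+ s₁) ℕ.+ (k₂ ℕ.+ s₂))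
      ≡⟨ cong (λ n → lev T ℤ.+ + n) (+-interchange k₁ s₁ k₂ s₂) ⟩
    lev T ℤ.+ + ((k₁ ℕ.+ k₂) ℕ.+ (s₁ ℕ.+ s₂)) ∎))
    where
    open ≡-Reasoning
    T : CObj
    T = target (target A k₁ s₁) k₂ s₂

  target-0 : ∀ A → target A 0 0 ≡ A
  target-0 A = obj-≡ (⊕-identityʳ (res A)) (ℤP.+-identityʳ (lev A))

  slack-cid : ∀ {A} → slack (cid {A}) ≡ 0
  slack-cid {A} = cong (λ z → ∣ z ∣ ∸ 0) (ℤP.+-inverseʳ (lev A))

  arrow-identity : ∀ A → arrow A 0 0 ≡ (A , cid)
  arrow-identity A = arrow-≡ (target-0 A) refl

  coords-∘ : ∀ {A X Y} {v : CHom A X} {h : CHom X Y} {w : CHom A Y} → h ∘C v ≡ w →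
             (a v ℕ.+ a h ≡ a w) × (slack v ℕ.+ slack h ≡ slack w)
  coords-∘ {v = v} {h} refl = refl , sym (slack-∘ h v)

  coords-second : ∀ {A X Y} {v : CHom A X} {h : CHom X Y} {w : CHom A Y} → h ∘C v ≡ w →
                  (a h ≡ a w ∸ a v) × (slack h ≡ slack w ∸ slack v)
  coords-second {v = v} {h} hv≡w with coords-∘ {v = v} {h} hv≡w
  ... | a≡ , s≡ = subtract a≡ , subtract s≡
    where
    subtract : ∀ {p q r} → p ℕ.+ q ≡ r → q ≡ r ∸ p
    subtract {p} {q} refl = sym (ℕP.m+n∸m≡n p q)

  cancel-first : ∀ {A X Y} {v : CHom A X} {h h′ : CHom X Y} {w : CHom A Y} →
                 h ∘C v ≡ w → h′ ∘C v ≡ w → h ≡ h′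
  cancel-first {v = v} {h} {h′} hv≡w h′v≡w =
    mor-≡ (ℕP.+-cancelˡ-≡ (a v) _ _ (trans (proj₁ (coords-∘ {v = v} {h} hv≡w))
                                           (sym (proj₁ (coords-∘ {v = v} {h′} h′v≡w)))))

  factor-through : ∀ {A X Y} (v : CHom A X) (w : CHom A Y) →
                   a v ≤ a w → slack v ≤ slack w → Σ[ h ∈ CHom X Y ] (h ∘C v ≡ w)
  factor-through {A} {X} {Y} v w a≤ s≤ =
    mkHom (a w ∸ a v) (slack w ∸ slack v) level resid , mor-≡ (ℕP.m+[n∸m]≡n a≤)
    where
    open ≡-Reasoning
    level : lev X ≡ lev Y ℤ.+ + ((a w ∸ a v) ℕ.+ (slack w ∸ slack v))
    level = drop-cancelˡ {lev A} {lev X} {lev Y} (drop v)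
      (subst (λ n → lev A ≡ lev Y ℤ.+ + n) (begin
      a w ℕ.+ slack w
        ≡⟨ cong₂ ℕ._+_ (ℕP.m+[n∸m]≡n a≤) (ℕP.m+[n∸m]≡n s≤) ⟨
      (a v ℕ.+ (a w ∸ a v)) ℕ.+ (slack v ℕ.+ (slack w ∸ slack v))
        ≡⟨ +-interchange (a v) (a w ∸ a v) (slack v) (slack w ∸ slack v) ⟩
      (a v ℕ.+ slack v) ℕ.+ ((a w ∸ a v) ℕ.+ (slack w ∸ slack v)) ∎) (drop w))
    resid : res X ⊕ (a w ∸ a v) ≡ res Y
    resid = begin
      res X ⊕ (a w ∸ a v)          ≡⟨ cong (_⊕ (a w ∸ a v)) (residue v) ⟩
      (res A ⊕ a v) ⊕ (a w ∸ a v)  ≡⟨ ⊕-assoc (res A) (a v) (a w ∸ a v) ⟩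
      res A ⊕ (a v ℕ.+ (a w ∸ a v)) ≡⟨ cong (res A ⊕_) (ℕP.m+[n∸m]≡n a≤) ⟩
      res A ⊕ a w                  ≡⟨ residue w ⟨
      res Y                        ∎

  factors⇒≤ : ∀ {A X Y} {v : CHom A X} {h : CHom X Y} {w : CHom A Y} → h ∘C v ≡ w →
              a v ≤ a w × slack v ≤ slack w
  factors⇒≤ {v = v} {h} {w} hv≡w with coords-∘ {v = v} {h} hv≡w
  ... | a≡ , s≡ = subst (a v ≤_) a≡ (ℕP.m≤m+n (a v) (a h))
                , subst (slack v ≤_) s≡ (ℕP.m≤m+n (slack v) (slack h))

  identity⇒coords : ∀ {A B} (f : CHom A B) → IsIdentity Cm f → a f ≡ 0 × slack f ≡ 0
  identity⇒coords {A} f (refl , refl) = refl , slack-cid {A}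

  coords⇒identity : ∀ {A B} (f : CHom A B) → a f ≡ 0 → slack f ≡ 0 → IsIdentity Cm f
  coords⇒identity {A} f a≡0 s≡0 = from-arrow (sym (begin
    (_ , f)                  ≡⟨ arrow-coords f ⟩
    arrow A (a f) (slack f)  ≡⟨ cong₂ (arrow A) a≡0 s≡0 ⟩
    arrow A 0 0              ≡⟨ arrow-identity A ⟩
    (A , cid)                ∎))
    where
    open ≡-Reasoning
    from-arrow : ∀ {B} {f : CHom A B} → _≡_ {A = Arrow A} (A , cid) (B , f) → IsIdentity Cm f
    from-arrow refl = refl , refl

module Factorizations (m : ℕ) (1<m : 1 < m) where
  open ≡ using (refl; sym; trans; cong; cong₂; subst; module ≡-Reasoning)
  open Coordinates m 1<m
  open import Data.Fin.Properties using (*↔×)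
  open import Function.Bundles using (_↔_; mk↔ₛ′)
  open import Function.Properties.Inverse using (↔-trans; ↔-sym)
  open import Axiom.UniquenessOfIdentityProofs.WithK using (uip)

  module Of {A B : CObj} (f : CHom A B) where
    Fact : Set
    Fact = Factorization Cm f

    aF sF : Fact → ℕ
    aF (_ , v , _ , _) = a v
    sF (_ , v , _ , _) = slack v

    aF≤ : ∀ F → aF F ≤ a f
    aF≤ (_ , v , u , e) = proj₁ (factors⇒≤ {v = v} {u} e)

    sF≤ : ∀ F → sF F ≤ slack f
    sF≤ (_ , v , u , e) = proj₂ (factors⇒≤ {v = v} {u} e)

    factorAt : ∀ k s → k ≤ a f → s ≤ slack f → Fact
    factorAt k s k≤ s≤ = target A k s , canonical A k s , proj₁ quotient , proj₂ quotient
      where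
      quotient : Σ[ u ∈ CHom (target A k s) B ] (u ∘C canonical A k s ≡ f)
      quotient = factor-through (canonical A k s) f k≤
                   (subst (_≤ slack f) (sym (slack-canonical A k s)) s≤)

    factorization-≡ : ∀ F G → aF F ≡ aF G → sF F ≡ sF G → F ≡ G
    factorization-≡ (X , v , u , e) (X′ , v′ , u′ , e′) a≡ s≡ = same-first (begin
      (X , v)                  ≡⟨ arrow-coords v ⟩
      arrow A (a v) (slack v)  ≡⟨ cong₂ (arrow A) a≡ s≡ ⟩
      arrow A (a v′) (slack v′) ≡⟨ arrow-coords v′ ⟨
      (X′ , v′)                ∎)
      where
      open ≡-Reasoning
      same-first : ∀ {X′ v′ u′ e′} → _≡_ {A = Arrow A} (X , v) (X′ , v′) →
                   _≡_ {A = Fact} (X , v , u , e) (X′ , v′ , u′ , e′)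
      same-first {u′ = u′} {e′} refl with cancel-first {v = v} {u} {u′} e e′
      ... | refl = cong (λ e → X , v , u , e) (uip e e′)

    Box : Set
    Box = Fin (suc (a f)) × Fin (suc (slack f))

    toBox : Fact → Box
    toBox F = fromℕ< (ℕ.s≤s (aF≤ F)) , fromℕ< (ℕ.s≤s (sF≤ F))

    fromBox : Box → Fact
    fromBox (i , j) =
      factorAt (toℕ i) (toℕ j) (ℕP.≤-pred (FinP.toℕ<n i)) (ℕP.≤-pred (FinP.toℕ<n j))

    Fact↔Box : Fact ↔ Box
    Fact↔Box = mk↔ₛ′ toBox fromBox to∘from from∘to
      where
      to∘from : ∀ x → toBox (fromBox x) ≡ x
      to∘from (i , j) = cong₂ _,_
        (FinP.toℕ-injective (FinP.toℕ-fromℕ< _))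
        (FinP.toℕ-injective (trans (FinP.toℕ-fromℕ< _) (slack-canonical A (toℕ i) (toℕ j))))
      from∘to : ∀ F → fromBox (toBox F) ≡ F
      from∘to F = factorization-≡ (fromBox (toBox F)) F (FinP.toℕ-fromℕ< _)
        (trans (slack-canonical A (toℕ (proj₁ (toBox F))) (toℕ (proj₂ (toBox F))))
               (FinP.toℕ-fromℕ< _))

    Fact↔Fin : Fact ↔ Fin (suc (a f) ℕ.* suc (slack f))
    Fact↔Fin = ↔-trans Fact↔Box (↔-sym *↔×)

  finiteFactorizations : FiniteFactorizations Cm
  finiteFactorizations f = _ , Of.Fact↔Fin f

module Interval (m : ℕ) (1<m : 1 < m) {A B : CmDef.CObj m 1<m} (f : CmDef.CHom m 1<m A B) where
  open ≡ using (refl; sym; trans; cong; cong₂; subst; isEquivalence)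
  open Coordinates m 1<m
  open Factorizations m 1<m
  open Of f
  open import Function.Bundles using (_↔_; mk↔ₛ′)
  open import Function.Properties.Inverse using (↔-trans)
  open import Axiom.UniquenessOfIdentityProofs.WithK using (uip)
  open import Relation.Binary.Structures using (IsPartialOrder)
  open import Relation.Binary.Lattice.Structures using (IsLattice)

  I : Category
  I = LawvereInterval Cm f

  toFact : IObj Cm f → Fact
  toFact (fact X v u e) = X , v , u , e

  fromFact : Fact → IObj Cm f
  fromFact (X , v , u , e) = fact X v u e

  IObj↔Fact : IObj Cm f ↔ Fact
  IObj↔Fact = mk↔ₛ′ toFact fromFact (λ _ → refl) (λ _ → refl)

  aI sI : IObj Cm f → ℕ
  aI P = a (IObj.v P)
  sI P = slack (IObj.v P)

  hom⇒≤ : ∀ {P Q : IObj Cm f} → IHom Cm P Q → aI P ≤ aI Q × sI P ≤ sI Q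
  hom⇒≤ {fact _ v _ _} (h , hv≡v′ , _) = factors⇒≤ {v = v} {h} hv≡v′

  aI-mono : ∀ P Q → IHom Cm P Q → aI P ≤ aI Q
  aI-mono P Q P≤Q = proj₁ (hom⇒≤ {P} {Q} P≤Q)

  sI-mono : ∀ P Q → IHom Cm P Q → sI P ≤ sI Q
  sI-mono P Q P≤Q = proj₂ (hom⇒≤ {P} {Q} P≤Q)

  ≤⇒hom : ∀ {P Q : IObj Cm f} → aI P ≤ aI Q → sI P ≤ sI Q → IHom Cm P Q
  ≤⇒hom {fact X v u e} {fact X′ v′ u′ e′} a≤ s≤ =
    h , hv≡v′ , cancel-first {v = v} {u′ ∘C h} {u} u′hv≡f e
    where
    h : CHom X X′
    h = proj₁ (factor-through v v′ a≤ s≤)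
    hv≡v′ : h ∘C v ≡ v′
    hv≡v′ = proj₂ (factor-through v v′ a≤ s≤)
    u′hv≡f : (u′ ∘C h) ∘C v ≡ f
    u′hv≡f = trans (Category.assoc Cm u′ h v) (trans (cong (u′ ∘C_) hv≡v′) e′)

  thin : ∀ {P Q : IObj Cm f} (g g′ : IHom Cm P Q) → g ≡ g′
  thin {fact _ v _ _} (h , hv , u′h) (h′ , h′v , u′h′) with cancel-first {v = v} {h} {h′} hv h′v
  ... | refl = cong₂ (λ p q → h , p , q) (uip hv h′v) (uip u′h u′h′)

  antisym : ∀ {P Q : IObj Cm f} → IHom Cm P Q → IHom Cm Q P → P ≡ Q
  antisym {P} {Q} P≤Q Q≤P = cong fromFact (factorization-≡ (toFact P) (toFact Q)
    (ℕP.≤-antisym (aI-mono P Q P≤Q) (aI-mono Q P Q≤P))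
    (ℕP.≤-antisym (sI-mono P Q P≤Q) (sI-mono Q P Q≤P)))

  aI≤ : ∀ P → aI P ≤ a f
  aI≤ (fact X v u e) = aF≤ (X , v , u , e)

  sI≤ : ∀ P → sI P ≤ slack f
  sI≤ (fact X v u e) = sF≤ (X , v , u , e)

  point : ℕ → ℕ → IObj Cm f
  point k s = fromFact (factorAt (k ℕ.⊓ a f) (s ℕ.⊓ slack f)
                                 (ℕP.m⊓n≤n k (a f)) (ℕP.m⊓n≤n s (slack f)))

  sI-point : ∀ k s → sI (point k s) ≡ s ℕ.⊓ slack f
  sI-point k s = slack-canonical A (k ℕ.⊓ a f) (s ℕ.⊓ slack f)

  ≤-point : ∀ {P : IObj Cm f} {k s} → aI P ≤ k → sI P ≤ s → IHom Cm P (point k s)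
  ≤-point {P} {k} {s} a≤ s≤ = ≤⇒hom {P} {point k s} (ℕP.⊓-glb a≤ (aI≤ P))
    (subst (sI P ≤_) (sym (sI-point k s)) (ℕP.⊓-glb s≤ (sI≤ P)))

  point-≤ : ∀ {P : IObj Cm f} {k s} → k ≤ aI P → s ≤ sI P → IHom Cm (point k s) P
  point-≤ {P} {k} {s} a≤ s≤ = ≤⇒hom {point k s} {P} (ℕP.≤-trans (ℕP.m⊓n≤m k (a f)) a≤)
    (subst (_≤ sI P) (sym (sI-point k s)) (ℕP.≤-trans (ℕP.m⊓n≤m s (slack f)) s≤))

  _∨_ _∧_ : IObj Cm f → IObj Cm f → IObj Cm f
  P ∨ Q = point (aI P ℕ.⊔ aI Q) (sI P ℕ.⊔ sI Q)
  P ∧ Q = point (aI P ℕ.⊓ aI Q) (sI P ℕ.⊓ sI Q)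

  isPartialOrder : IsPartialOrder _≡_ (IHom Cm {f = f})
  isPartialOrder = record
    { isPreorder = record
      { isEquivalence = isEquivalence
      ; reflexive = reflexive
      ; trans = λ {P} {Q} {R} P≤Q Q≤R → Category._∘_ I {P} {Q} {R} Q≤R P≤Q }
    ; antisym = antisym }
    where
    reflexive : ∀ {P Q : IObj Cm f} → P ≡ Q → IHom Cm P Q
    reflexive {P} refl = Category.id I {P}

  isLattice : IsLattice _≡_ (IHom Cm {f = f}) _∨_ _∧_
  isLattice = record
    { isPartialOrder = isPartialOrder
    ; supremum = λ P Q →
        ≤-point {P} (ℕP.m≤m⊔n _ _) (ℕP.m≤m⊔n _ _) , ≤-point {Q} (ℕP.m≤n⊔m _ _) (ℕP.m≤n⊔m _ _)
        , λ R P≤R Q≤R → point-≤ {R} (ℕP.⊔-lub (aI-mono P R P≤R) (aI-mono Q R Q≤R))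
                                    (ℕP.⊔-lub (sI-mono P R P≤R) (sI-mono Q R Q≤R))
    ; infimum = λ P Q →
        point-≤ {P} (ℕP.m⊓n≤m _ _) (ℕP.m⊓n≤m _ _) , point-≤ {Q} (ℕP.m⊓n≤n _ _) (ℕP.m⊓n≤n _ _)
        , λ R R≤P R≤Q → ≤-point {R} (ℕP.⊓-glb (aI-mono R P R≤P) (aI-mono R Q R≤Q))
                                    (ℕP.⊓-glb (sI-mono R P R≤P) (sI-mono R Q R≤Q))
    }

  isFiniteLattice : IsFiniteLattice I
  isFiniteLattice = record
    { finiteObj = _ , ↔-trans IObj↔Fact Fact↔Fin
    ; thin = λ {P} {Q} → thin {P} {Q}
    ; oneWay = antisym
    ; lattice = _∨_ , _∧_ , isLattice }

module Möbius (m : ℕ) (1<m : 1 < m) (K : CommutativeRing 0ℓ 0ℓ) where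
  open Coordinates m 1<m
  open Factorizations m 1<m
  open CommutativeRing K renaming (Carrier to K₀)
  open AntidiagonalSums K
  open ActionAlgebra K CObj target target-+ target-0
  open Incidence Cm K finiteFactorizations
    using (IncidenceFunction; sumK; conv; IsDelta; HasInverse)
  open import Algebra.Properties.Semiring.Sum semiring using (sum; sum-cong-≋)
  open import Relation.Binary.Reasoning.Setoid setoid

  coordinatewise : IncidenceFunction → Fn
  coordinatewise ξ A k s = ξ (canonical A k s)

  ξ-coords : ∀ (ξ : IncidenceFunction) {A B} (g : CHom A B) →
             ξ g ≡ coordinatewise ξ A (a g) (slack g)
  ξ-coords ξ {A} g = ≡.cong (λ (p : Arrow A) → ξ (proj₂ p)) (arrow-coords g)

  ξ-identity : ∀ (ξ : IncidenceFunction) A → coordinatewise ξ A 0 0 ≡ ξ (cid {A})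
  ξ-identity ξ A = ≡.cong (λ (p : Arrow A) → ξ (proj₂ p)) (arrow-identity A)

  onArrows : Fn → IncidenceFunction
  onArrows Φ {A} g = Φ A (a g) (slack g)

  coordinatewise-onArrows : ∀ Φ → coordinatewise (onArrows Φ) ∼ Φ
  coordinatewise-onArrows Φ A k s = reflexive (≡.cong (Φ A k) (slack-canonical A k s))

  sumK≡sum : ∀ n (φ : Fin n → K₀) → sumK n φ ≡ sum φ
  sumK≡sum zero    φ = ≡.refl
  sumK≡sum (suc n) φ = ≡.cong (λ x → φ Fin.zero + x) (sumK≡sum n (λ i → φ (Fin.suc i)))

  -- The incidence convolution of C_m is the convolution of the ℕ²-action: conv sums
  -- over the box of factorizations, i.e. over pairs of antidiagonals.
  conv≈⋆ : ∀ (ξ η : IncidenceFunction) {A B} (f : CHom A B) →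
           conv ξ η f ≈ (coordinatewise ξ ⋆ coordinatewise η) A (a f) (slack f)
  conv≈⋆ ξ η {A} {B} f = begin
    conv ξ η f
      ≡⟨ sumK≡sum (suc a₀ ℕ.* suc s₀) (λ k → term (Fin.remQuot (suc s₀) k)) ⟩
    sum (λ k → term (Fin.remQuot (suc s₀) k))
      ≈⟨ sum-combine (suc a₀) (suc s₀) (λ k → term (Fin.remQuot (suc s₀) k)) ⟩
    ∑ᵢ (λ i → ∑ⱼ (λ j → term (Fin.remQuot (suc s₀) (Fin.combine i j))))
      ≈⟨ sum-cong-≋ (λ i → sum-cong-≋ (λ j → reflexive (≡.cong term (FinP.remQuot-combine i j)))) ⟩
    ∑ᵢ (λ i → ∑ⱼ (λ j → term (i , j)))
      ≈⟨ sum-cong-≋ (λ i → sum-cong-≋ (λ j → term-coords i j)) ⟩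
    ∑ᵢ (λ i → ∑ⱼ (λ j → G (toℕ i) (a₀ ∸ toℕ i) (toℕ j) (s₀ ∸ toℕ j)))
      ≈⟨ sum-cong-≋ {suc a₀} (λ i → sum-antidiagonal s₀ (G (toℕ i) (a₀ ∸ toℕ i))) ⟩
    ∑ᵢ (λ i → Σ⟨ s₀ ⟩ (G (toℕ i) (a₀ ∸ toℕ i)))
      ≈⟨ sum-antidiagonal a₀ (λ a₁ a₂ → Σ⟨ s₀ ⟩ (G a₁ a₂)) ⟩
    (coordinatewise ξ ⋆ coordinatewise η) A a₀ s₀ ∎
    where
    open Of f
    a₀ s₀ : ℕ
    a₀ = a f
    s₀ = slack f
    ∑ᵢ : (Fin (suc a₀) → K₀) → K₀
    ∑ᵢ = sum
    ∑ⱼ : (Fin (suc s₀) → K₀) → K₀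
    ∑ⱼ = sum
    G : ℕ → ℕ → ℕ → ℕ → K₀
    G a₁ a₂ s₁ s₂ = coordinatewise ξ (target A a₁ s₁) a₂ s₂ * coordinatewise η A a₁ s₁
    term : Box → K₀
    term x = ξ (proj₁ (proj₂ (proj₂ (fromBox x)))) * η (proj₁ (proj₂ (fromBox x)))
    term-coords : ∀ i j → term (i , j) ≈ G (toℕ i) (a₀ ∸ toℕ i) (toℕ j) (s₀ ∸ toℕ j)
    term-coords i j = *-cong (reflexive (≡.trans (ξ-coords ξ u) (≡.cong₂ (coordinatewise ξ _)
      (proj₁ u-coords)
      (≡.trans (proj₂ u-coords) (≡.cong (s₀ ∸_) (slack-canonical A (toℕ i) (toℕ j))))))) refl
      where
      u : CHom (target A (toℕ i) (toℕ j)) B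
      u = proj₁ (proj₂ (proj₂ (fromBox (i , j))))
      u-coords : (a u ≡ a₀ ∸ toℕ i) × (slack u ≡ s₀ ∸ slack (canonical A (toℕ i) (toℕ j)))
      u-coords = coords-second {v = canonical A (toℕ i) (toℕ j)} {u}
                               (proj₂ (proj₂ (proj₂ (fromBox (i , j)))))

  conv≈⋆′ : ∀ (ξ η : IncidenceFunction) Φ Ψ → coordinatewise ξ ∼ Φ → coordinatewise η ∼ Ψ →
            ∀ {A B} (f : CHom A B) → conv ξ η f ≈ (Φ ⋆ Ψ) A (a f) (slack f)
  conv≈⋆′ ξ η Φ Ψ ξ∼Φ η∼Ψ {A} f =
    trans (conv≈⋆ ξ η f)
          (⋆-cong {coordinatewise ξ} {Φ} {coordinatewise η} {Ψ} ξ∼Φ η∼Ψ A (a f) (slack f))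

  isDelta : ∀ (ζ : IncidenceFunction) →
            (∀ {A B} (f : CHom A B) → ζ f ≈ δ A (a f) (slack f)) → IsDelta ζ
  isDelta ζ ζ≈δ f = on-identity , off-identity
    where
    on-identity : IsIdentity Cm f → ζ f ≈ 1#
    on-identity id-f with identity⇒coords f id-f
    ... | a≡0 , s≡0 = trans (ζ≈δ f)
      (trans (reflexive (≡.cong₂ (λ k s → δ₀ k * δ₀ s) a≡0 s≡0)) (*-identityˡ 1#))
    δ-off : ∀ k s → ¬ (k ≡ 0 × s ≡ 0) → δ₀ k * δ₀ s ≈ 0#
    δ-off zero    zero    not-origin = ⊥-elim (not-origin (≡.refl , ≡.refl))
    δ-off zero    (suc s) _          = zeroʳ _
    δ-off (suc k) s       _          = zeroˡ _
    off-identity : ¬ IsIdentity Cm f → ζ f ≈ 0#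
    off-identity ¬id-f = trans (ζ≈δ f)
      (δ-off (a f) (slack f) (λ { (a≡0 , s≡0) → ¬id-f (coords⇒identity f a≡0 s≡0) }))

  inverse⇒nonzero : ¬ (1# ≈ 0#) → ∀ (ξ : IncidenceFunction) → HasInverse ξ →
                    ∀ {A} → ¬ (ξ (cid {A}) ≈ 0#)
  inverse⇒nonzero 1≉0 ξ (η , ξη≈δ , _) {A} ξ≈0 =
    proj₁ (origin-nonzero 1≉0 (coordinatewise ξ) (coordinatewise η) A unit)
          (trans (reflexive (ξ-identity ξ A)) ξ≈0)
    where
    unit : (coordinatewise ξ ⋆ coordinatewise η) A 0 0 ≈ 1#
    unit = begin
      (coordinatewise ξ ⋆ coordinatewise η) A 0 0
        ≡⟨ ≡.cong ((coordinatewise ξ ⋆ coordinatewise η) A 0) (slack-cid {A}) ⟨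
      (coordinatewise ξ ⋆ coordinatewise η) A 0 (slack (cid {A}))
        ≈⟨ conv≈⋆ ξ η cid ⟨
      conv ξ η cid
        ≈⟨ proj₁ (ξη≈δ (cid {A})) (≡.refl , ≡.refl) ⟩
      1# ∎

  nonzero⇒inverse : IsField K → ∀ (ξ : IncidenceFunction) →
                    (∀ {A} → ¬ (ξ (cid {A}) ≈ 0#)) → HasInverse ξ
  nonzero⇒inverse isField ξ ξ≉0 =
    onArrows ρ , isDelta (conv ξ (onArrows ρ)) ξρ≈δ , isDelta (conv (onArrows ρ) ξ) ρξ≈δ
    where
    Φ : Fn
    Φ = coordinatewise ξ
    Φ≉0 : ∀ X → ¬ (Φ X 0 0 ≈ 0#)
    Φ≉0 X Φ≈0 = ξ≉0 (trans (reflexive (≡.sym (ξ-identity ξ X))) Φ≈0)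
    inverse : Σ[ ρ ∈ Fn ] (Φ ⋆ ρ ∼ δ × ρ ⋆ Φ ∼ δ)
    inverse = ⋆-inverse isField Φ Φ≉0
    ρ : Fn
    ρ = proj₁ inverse
    ρ≈ : coordinatewise (onArrows ρ) ∼ ρ
    ρ≈ = coordinatewise-onArrows ρ
    ξρ≈δ : ∀ {A B} (f : CHom A B) → conv ξ (onArrows ρ) f ≈ δ A (a f) (slack f)
    ξρ≈δ {A} f = trans (conv≈⋆′ ξ (onArrows ρ) Φ ρ (λ _ _ _ → refl) ρ≈ f)
                       (proj₁ (proj₂ inverse) A (a f) (slack f))
    ρξ≈δ : ∀ {A B} (f : CHom A B) → conv (onArrows ρ) ξ f ≈ δ A (a f) (slack f)
    ρξ≈δ {A} f = trans (conv≈⋆′ (onArrows ρ) ξ ρ Φ ρ≈ (λ _ _ _ → refl) f)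
                       (proj₂ (proj₂ inverse) A (a f) (slack f))

  möbius : IsField K → IsMöbius K Cm
  möbius isField@(1≉0 , _) =
    finiteFactorizations , λ ξ → inverse⇒nonzero 1≉0 ξ , nonzero⇒inverse isField ξ

proposition3p4 : (m : ℕ) (1<m : 1 < m) →
    ((K : CommutativeRing 0ℓ 0ℓ) → IsField K → IsMöbius K (C m 1<m))
    × (∀ {A B} (f : Category.Hom (C m 1<m) A B) →
         IsFiniteLattice (LawvereInterval (C m 1<m) f))
proposition3p4 m 1<m = (λ K isField → Möbius.möbius m 1<m K isField)
                     , (λ f → Interval.isFiniteLattice m 1<m f)
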